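{- Let $\mathfrak p\in{}^*\mathbb Z$ be a prime of ${}^*\mathbb Z$ and let $\mathbf i\in{}^*\mathbb Z$ be such that there exist $\mathfrak l,\mathfrak m,\mathbf j\in{}^*\mathbb Z$ with: $n\mid\mathfrak m$ for every standard $n\in\mathbb N$, $\mathfrak m^2=\mathfrak l$, $\mathfrak m\mid\mathbf j$, $\mathbf j^2=\mathbf i$ and $\mathbf i\mid(\mathfrak p-1)$. Assume moreover that if $\mathbf i^2\neq\mathfrak p-1$ then for every $k\in\mathbb N$ and all standard integers $a_1,\dots,a_k\in\mathbb Z$ one has $\mathbf i^k+a_1\mathbf i^{k-1}+\dots+a_k\not\equiv0\pmod{\mathfrak p}$. Then there exists $\epsilon\in{\rm F}_{\mathfrak p}$ such that (i) for every $\eta\in{}^*\mathbb Z$, $\epsilon^\eta=1$ in ${\rm F}_\mathfrak p$ if and only if $(\mathfrak p-1)\mid\eta$, and (ii) the element $\alpha:=\epsilon^{(\mathfrak p-1)/\mathbf i}$ does not belong to ${\rm acl}(\mathbb Q[\mathbf i])$, i.e. $\alpha$ is transcendental over the subfield of ${\rm F}_\mathfrak p$ generated by $\mathbf i \bmod \mathfrak p$.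
   Context: Let $P$ be the set of prime numbers, $D$ a non-principal ultrafilter on $P$, and ${}^*\mathbb Z=\mathbb Z^P/D$ the ultrapower of the integers (non-standard integers); $\mathbb N$, $\mathbb Z$ denote the standard elements. For $N\le M$ in ${}^*\mathbb Z$ write ${}^*\mathbb Z[N:M]=\{z\in{}^*\mathbb Z: N\le z\le M\}$. For a prime $\mathfrak p$ of ${}^*\mathbb Z$, ${\rm F}_\mathfrak p={}^*\mathbb Z/\mathfrak p{}^*\mathbb Z$ (a pseudo-finite field, of characteristic $0$ when $\mathfrak p$ is non-standard); elements of ${}^*\mathbb Z$ are read in ${\rm F}_\mathfrak p$ modulo $\mathfrak p$. For $X\subseteq{\rm F}_\mathfrak p$, ${\rm acl}(X)$ denotes the set of elements of ${\rm F}_\mathfrak p$ algebraic over the subfield generated by $X$. -}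

module Defs where

open import Level using (0ℓ)
open import Data.Nat using (ℕ; zero; suc)
open import Data.Nat.Primality using (Prime)
open import Data.Integer as ℤ using (ℤ; +_; ∣_∣)
open import Data.Product using (Σ; ∃; _×_; _,_; proj₁)
open import Data.Unit using (⊤)
open import Data.Empty using (⊥)
open import Data.Sum using (_⊎_)
open import Data.List using (List; []; _∷_)
open import Data.Vec using (Vec; []; _∷_; foldl; lookup; map)
open import Data.Fin using (Fin)
open import Relation.Nullary using (¬_)
open import Relation.Unary using (Pred; _⊆_; _∩_; ∁)
open import Relation.Binary.PropositionalEquality using (_≡_)

PrimeIdx : Set
PrimeIdx = Σ ℕ Prime

record Ultrafilter : Set₁ where
  field
    member   : Pred PrimeIdx 0ℓ → Set
    full     : member (λ _ → ⊤)
    proper   : ¬ member (λ _ → ⊥)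
    upward   : ∀ {A B} → A ⊆ B → member A → member B
    meet     : ∀ {A B} → member A → member B → member (A ∩ B)
    ultra    : ∀ A → member A ⊎ member (∁ A)

NonPrincipal : Ultrafilter → Set
NonPrincipal D = ∀ (n : ℕ) → ¬ Ultrafilter.member D (λ q → proj₁ q ≡ n)

-- The ultrapower *Z = Z^P / D, presented as a setoid.
module UP (D : Ultrafilter) where
  open Ultrafilter D

  *ℤ : Set
  *ℤ = PrimeIdx → ℤ

  _≈_ : *ℤ → *ℤ → Set
  x ≈ y = member (λ q → x q ≡ y q)
  infix 4 _≈_

  _<_ : *ℤ → *ℤ → Set
  x < y = member (λ q → x q ℤ.< y q)
  infix 4 _<_

  κ : ℤ → *ℤ
  κ a _ = a

  _+_ _-_ _*_ : *ℤ → *ℤ → *ℤ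
  (x + y) q = x q ℤ.+ y q
  (x - y) q = x q ℤ.- y q
  (x * y) q = x q ℤ.* y q
  infixl 6 _+_ _-_
  infixl 7 _*_

  _∣_ : *ℤ → *ℤ → Set
  a ∣ b = Σ *ℤ λ c → b ≈ c * a
  infix 4 _∣_

  IsPrime : *ℤ → Set
  IsPrime p = (κ (+ 1) < p) × (∀ a b → p ∣ a * b → (p ∣ a) ⊎ (p ∣ b))

  -- congruence modulo p, i.e. equality in F_p = *Z / p*Z
  _≡_[mod_] : *ℤ → *ℤ → *ℤ → Set
  a ≡ b [mod p ] = p ∣ (a - b)
  infix 4 _≡_[mod_]

  -- internal exponentiation ε^η (computed coordinatewise); exponent taken in
  -- absolute value
  pow : *ℤ → *ℤ → *ℤ
  pow e n q = e q ℤ.^ ∣ n q ∣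

  -- value of a monic integer polynomial X^k + a₁X^{k-1} + … + a_k at x
  monicEval : ∀ {k} → *ℤ → Vec ℤ k → *ℤ
  monicEval x as = foldl (λ _ → *ℤ) (λ acc a → acc * x + κ a) (κ (+ 1)) as

  -- value of an integer polynomial (coefficient list, constant term first) at x
  polyEval : List ℤ → *ℤ → *ℤ
  polyEval [] x = κ (+ 0)
  polyEval (c ∷ cs) x = κ c + x * polyEval cs x

  sumPow : ∀ {d} → Vec *ℤ d → *ℤ → *ℤ
  sumPow [] y = κ (+ 0)
  sumPow (c ∷ cs) y = c + y * sumPow cs y

  -- α ∈ F_p is algebraic over the subfield of F_p generated by i:
  -- α is a root of a polynomial whose coefficients lie in Z[i mod p] and are
  -- not all 0 in F_p (denominators cleared).
  AlgOver : (p i α : *ℤ) → Set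
  AlgOver p i α =
    Σ ℕ λ d → Σ (Vec (List ℤ) d) λ hs →
      (Σ (Fin d) λ k → ¬ (polyEval (lookup hs k) i ≡ κ (+ 0) [mod p ]))
      × (sumPow (map (λ h → polyEval h i) hs) α ≡ κ (+ 0) [mod p ])

-- Everything is done coordinatewise. At a coordinate where p is a prime P with P - 1 = C J²
-- (C and J the coordinates of (p - 1) / i and j), the units modulo P are cyclic: an element g of
-- maximal order M is a generator, since every unit is then a root of X^M - 1, which has at most M
-- roots. Writing s for the part of C coprime to J, the generators g ^ (1 + t J s) with t < J have
-- pairwise distinct C-th powers, so one of them has a C-th power avoiding the roots of any family
-- of nonzero polynomials of total length below J. Enumerating the polynomials over ℤ[i] and letting
-- the family grow with J, which exceeds every standard bound on a D-large set because every standard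
-- integer divides j, each algebraic relation for α = ε ^ ((p - 1) / i) fails on a D-large set.

module Submission where

open import Defs
open import Data.Nat using (ℕ; suc)
open import Data.Integer using (ℤ; +_)
open import Data.Vec using (Vec)
open import Data.Product using (Σ; _×_; _,_; proj₁)
open import Relation.Nullary using (¬_)
open import Function.Bundles using (_⇔_)
open import Data.Integer.Divisibility.Signed using () renaming (_∣_ to _∣ℤ_; ∣-trans to ∣ℤ-trans)

module NatArithmetic where

  open import Data.Nat
  open import Data.Nat.Properties
  open import Data.Nat.Divisibility
  open import Data.Nat.Coprimality using (Coprime; coprime-divisor; coprime?; gcd≡1⇒coprime; coprime⇒gcd≡1)
  open import Data.Nat.GCD using (gcd; gcd[m,n]∣m; gcd[m,n]∣n; gcd-greatest; gcd[m,n]≢0)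
  open import Data.Nat.LCM using (lcm; lcm-least; gcd*lcm)
  open import Data.Nat.Primality
  open import Data.Nat.Primality.Factorisation using (factorise; PrimeFactorisation)
  open import Data.Nat.ListAction using (product)
  open import Data.List using ([]; _∷_)
  open import Data.List.Relation.Unary.All using (All; _∷_)
  open import Data.Product using (∃; _,_; _×_; proj₁; proj₂)
  open import Data.Sum using (_⊎_; inj₁; inj₂; [_,_]′)
  open import Induction.WellFounded using (Acc; acc)
  open import Data.Nat.Induction using (<-wellFounded)
  open import Relation.Nullary using (¬_; Dec; yes; no)
  open import Relation.Nullary.Negation using (contradiction)
  open import Data.Empty using (⊥-elim)
  open import Relation.Binary.PropositionalEquality

  coprime-*ʳ : ∀ {a b c} → Coprime a b → Coprime a c → Coprime a (b * c)
  coprime-*ʳ cab cac (d∣a , d∣bc) =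
    cac (d∣a , coprime-divisor (λ (e∣d , e∣b) → cab (∣-trans e∣d d∣a , e∣b)) d∣bc)

  coprime-^ʳ : ∀ {a b} e → Coprime a b → Coprime a (b ^ e)
  coprime-^ʳ zero    _   (_ , d∣1) = ∣1⇒≡1 d∣1
  coprime-^ʳ (suc e) cab = coprime-*ʳ cab (coprime-^ʳ e cab)

  ∤-prime⇒coprime : ∀ {r m} → Prime r → ¬ r ∣ m → Coprime m r
  ∤-prime⇒coprime r-prime r∤m (d∣m , d∣r) with prime⇒irreducible r-prime d∣r
  ... | inj₁ d≡1 = d≡1
  ... | inj₂ refl = contradiction d∣m r∤m

  coprime⇒*∣ : ∀ {s t k} → Coprime s t → s ∣ k → t ∣ k → s * t ∣ k
  coprime⇒*∣ {s} {t} cop s∣k t∣k =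
    subst (_∣ _) lcm≡s*t (lcm-least s∣k t∣k)
    where
    lcm≡s*t : lcm s t ≡ s * t
    lcm≡s*t = begin
      lcm s t            ≡⟨ *-identityˡ (lcm s t) ⟨
      1 * lcm s t        ≡⟨ cong (_* lcm s t) (coprime⇒gcd≡1 cop) ⟨
      gcd s t * lcm s t  ≡⟨ gcd*lcm s t ⟩
      s * t              ∎
      where open ≡-Reasoning

  prime⇒∸1≢0 : ∀ {p} → Prime p → NonZero (p ∸ 1)
  prime⇒∸1≢0 {p} p-prime = >-nonZero (m<n⇒0<n∸m (nonTrivial⇒n>1 p {{prime⇒nonTrivial p-prime}}))

  ∃-prime-divisor : ∀ n → .{{NonTrivial n}} → ∃ λ r → Prime r × r ∣ n
  ∃-prime-divisor n = pick (factors F) (isFactorisation F) (factorsPrime F)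
    where
    instance _ = nonTrivial⇒nonZero n
    F = factorise n
    open PrimeFactorisation
    pick : ∀ rs → n ≡ product rs → All Prime rs → ∃ λ r → Prime r × r ∣ n
    pick []       n≡1 _ = contradiction n≡1 (nonTrivial⇒≢1 {n})
    pick (r ∷ rs) n≡r* (r-prime ∷ _) = r , r-prime , subst (r ∣_) (sym n≡r*) (m∣m*n (product rs))

  record PowerSplit (r n : ℕ) : Set where
    field
      exponent cofactor : ℕ
      n≡r^exponent*cofactor : n ≡ r ^ exponent * cofactor
      r∤cofactor : ¬ r ∣ cofactor

  powerSplit : ∀ r n → .{{NonTrivial r}} → .{{NonZero n}} → PowerSplit r n
  powerSplit r n = go n (<-wellFounded n)
    where
    go : ∀ n → .{{NonZero n}} → Acc _<_ n → PowerSplit r n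
    go n (acc rec) with r ∣? n
    ... | no r∤n = record
      { exponent = 0 ; cofactor = n ; n≡r^exponent*cofactor = sym (+-identityʳ n) ; r∤cofactor = r∤n }
    ... | yes (divides q refl) = record
      { exponent = suc exponent ; cofactor = cofactor ; r∤cofactor = r∤cofactor
      ; n≡r^exponent*cofactor = begin
          q * r                         ≡⟨ cong (_* r) n≡r^exponent*cofactor ⟩
          r ^ exponent * cofactor * r   ≡⟨ *-comm _ r ⟩
          r * (r ^ exponent * cofactor) ≡⟨ *-assoc r (r ^ exponent) cofactor ⟨
          r ^ suc exponent * cofactor   ∎ }
      where
      open ≡-Reasoning
      instance _ = m*n≢0⇒m≢0 q
      open PowerSplit (go q (rec (m<m*n q r (nonTrivial⇒n>1 r))))

  m^n∣m^o : ∀ m {n o} → n ≤ o → m ^ n ∣ m ^ o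
  m^n∣m^o m {n} {o} n≤o = divides (m ^ (o ∸ n))
    (trans (cong (m ^_) (sym (m+[n∸m]≡n n≤o))) (trans (^-distribˡ-+-* m n (o ∸ n)) (*-comm (m ^ n) _)))

  record PrimePowerGap (t M : ℕ) : Set where
    field
      r a e t' M' : ℕ
      r-prime : Prime r
      t≡ : t ≡ r ^ e * t'
      M≡ : M ≡ r ^ a * M'
      r∤M' : ¬ r ∣ M'
      a<e : a < e

  ∤⇒primePowerGap : ∀ {t M} → .{{NonZero t}} → .{{NonZero M}} → ¬ t ∣ M → PrimePowerGap t M
  ∤⇒primePowerGap {t} {M} t∤M = record
    { r = r ; a = a ; e = e ; t' = t' ; M' = M' ; r-prime = r-prime
    ; t≡ = t≡ ; M≡ = M≡ ; r∤M' = r∤M' ; a<e = ≰⇒> e≰a }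
    where
    g = gcd t M
    t₁ = quotient (gcd[m,n]∣m t M)
    t₁*g∣t : t₁ * g ∣ t
    t₁*g∣t = ∣-reflexive (sym (m∣n⇒n≡quotient*m (gcd[m,n]∣m t M)))
    g<t : g < t
    g<t = ≤∧≢⇒< (∣⇒≤ (gcd[m,n]∣m t M)) (λ g≡t → t∤M (subst (_∣ M) g≡t (gcd[m,n]∣n t M)))
    instance _ = n>1⇒nonTrivial (quotient>1 (gcd[m,n]∣m t M) g<t)
    r-divisor = ∃-prime-divisor t₁
    r = proj₁ r-divisor
    r-prime = proj₁ (proj₂ r-divisor)
    instance
      r-nonTrivial = prime⇒nonTrivial r-prime
    open PowerSplit (powerSplit r t) using ()
      renaming (exponent to e; cofactor to t'; n≡r^exponent*cofactor to t≡; r∤cofactor to r∤t')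
    open PowerSplit (powerSplit r M) using ()
      renaming (exponent to a; cofactor to M'; n≡r^exponent*cofactor to M≡; r∤cofactor to r∤M')
    -- r ^ e ∣ gcd t M together with r ∣ t / gcd t M would give r ^ (e + 1) ∣ t
    e≰a : ¬ e ≤ a
    e≰a e≤a = r∤t' (*-cancelˡ-∣ (r ^ e) {{m^n≢0 r e {{nonTrivial⇒nonZero r}}}} r^e*r∣r^e*t')
      where
      r^e∣g : r ^ e ∣ g
      r^e∣g = gcd-greatest (subst (r ^ e ∣_) (sym t≡) (m∣m*n t'))
                           (subst (r ^ e ∣_) (sym M≡) (∣m⇒∣m*n M' (m^n∣m^o r e≤a)))
      r^e*r∣r^e*t' : r ^ e * r ∣ r ^ e * t'
      r^e*r∣r^e*t' = subst₂ _∣_ (*-comm r (r ^ e)) t≡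
        (∣-trans (*-monoʳ-∣ r r^e∣g) (∣-trans (*-monoˡ-∣ g (proj₂ (proj₂ r-divisor))) t₁*g∣t))

  ∣⇒coprime-1+ : ∀ {m k} → m ∣ k → Coprime (suc k) m
  ∣⇒coprime-1+ {k = k} m∣k {d} (d∣1+k , d∣m) =
    ∣1⇒≡1 (∣m+n∣m⇒∣n (subst (d ∣_) (+-comm 1 k) d∣1+k) (∣-trans d∣m m∣k))

  record CoprimePart (C J : ℕ) : Set where
    field
      s S : ℕ
      C≡s*S : C ≡ s * S
      s-coprime : Coprime s J
      coprime⇒coprime-S : ∀ {u} → Coprime u J → Coprime u S

  coprimePart : ∀ C J → .{{NonZero C}} → CoprimePart C J
  coprimePart C J = go C (<-wellFounded C)
    where
    go : ∀ C → .{{NonZero C}} → Acc _<_ C → CoprimePart C J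
    go C (acc rec) with coprime? C J
    ... | yes C-coprime = record
      { s = C ; S = 1 ; C≡s*S = sym (*-identityʳ C) ; s-coprime = C-coprime
      ; coprime⇒coprime-S = λ _ (_ , d∣1) → ∣1⇒≡1 d∣1 }
    ... | no ¬C-coprime = record
      { s = s ; S = S * g ; C≡s*S = C≡ ; s-coprime = s-coprime
      ; coprime⇒coprime-S = λ u-cop →
          coprime-*ʳ (coprime⇒coprime-S u-cop) (λ (d∣u , d∣g) → u-cop (d∣u , ∣-trans d∣g (gcd[m,n]∣n C J))) }
      where
      g = gcd C J
      C₁ = quotient (gcd[m,n]∣m C J)
      1<g : 1 < g
      1<g with gcd C J in g≡
      ... | 0    = contradiction g≡ (gcd[m,n]≢0 C J (inj₁ (≢-nonZero⁻¹ C)))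
      ... | 1    = ⊥-elim (¬C-coprime (gcd≡1⇒coprime g≡))
      ... | 2+ _ = sz<ss
      instance
        _ = n>1⇒nonTrivial 1<g
        _ = quotient≢0 (gcd[m,n]∣m C J)
      open CoprimePart (go C₁ (rec (quotient-< (gcd[m,n]∣m C J))))
      C≡ : C ≡ s * (S * g)
      C≡ = begin
        C           ≡⟨ m∣n⇒n≡quotient*m (gcd[m,n]∣m C J) ⟩
        C₁ * g      ≡⟨ cong (_* g) C≡s*S ⟩
        s * S * g   ≡⟨ *-assoc s S g ⟩
        s * (S * g) ∎
        where open ≡-Reasoning

  -- junk value (1 , n) when n is not composite
  splitComposite : ℕ → ℕ × ℕ
  splitComposite n with composite? n
  ... | yes (hasNonTrivialDivisor {d} _ d∣n) = d , quotient d∣n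
  ... | no  _                               = 1 , n

  record ProperFactors (n a b : ℕ) : Set where
    field
      a*b≡n : a * b ≡ n
      0<a   : 0 < a
      a<n   : a < n
      0<b   : 0 < b
      b<n   : b < n

  splitComposite-proper : ∀ {n} → 1 < n → ¬ Prime n →
                          ProperFactors n (proj₁ (splitComposite n)) (proj₂ (splitComposite n))
  splitComposite-proper {n} 1<n ¬prime with composite? n
  ... | no ¬composite = ⊥-elim (¬composite (¬prime⇒composite {{n>1⇒nonTrivial 1<n}} ¬prime))
  ... | yes (hasNonTrivialDivisor {d} d<n d∣n) = record
    { a*b≡n = trans (*-comm d (quotient d∣n)) (sym (m∣n⇒n≡quotient*m d∣n))
    ; 0<a   = <-trans z<s (nonTrivial⇒n>1 d)
    ; a<n   = d<n
    ; 0<b   = >-nonZero⁻¹ (quotient d∣n) {{quotient≢0 d∣n}}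
    ; b<n   = quotient-< d∣n }
    where instance _ = >-nonZero (<-trans z<s 1<n)

  module _ {Q : ℕ → Set} (Q? : ∀ n → Dec (Q n)) where

    least-below? : ∀ n → (∃ λ m → Q m × m < n × (∀ {k} → k < m → ¬ Q k)) ⊎ (∀ {k} → k < n → ¬ Q k)
    least-below? zero    = inj₂ λ ()
    least-below? (suc n) with least-below? n
    ... | inj₁ (m , Qm , m<n , minimal) = inj₁ (m , Qm , m<n⇒m<1+n m<n , minimal)
    ... | inj₂ none with Q? n
    ...   | yes Qn  = inj₁ (n , Qn , n<1+n n , none)
    ...   | no  ¬Qn = inj₂ λ k<1+n → [ none , (λ { refl → ¬Qn }) ]′ (m<1+n⇒m<n∨m≡n k<1+n)

    ∃-least : ∀ {n} → Q n → ∃ λ m → Q m × m ≤ n × (∀ {k} → k < m → ¬ Q k)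
    ∃-least {n} Qn with least-below? (suc n)
    ... | inj₁ (m , Qm , m<1+n , minimal) = m , Qm , s≤s⁻¹ m<1+n , minimal
    ... | inj₂ none                       = contradiction Qn (none (n<1+n n))

module ListCounting where

  open import Data.List using ([]; _∷_; length; filter)
  open import Data.Nat using (suc; _+_)
  open import Data.Nat.Properties using (+-suc)
  open import Relation.Nullary using (yes; no; ¬?)
  open import Relation.Unary using (Pred; Decidable)
  open import Level using (0ℓ)
  open import Relation.Binary.PropositionalEquality
  open import Function using (_∘_)

  length-filter+length-filter-¬ : ∀ {A : Set} {P : Pred A 0ℓ} (P? : Decidable P) xs →
                                  length (filter P? xs) + length (filter (¬? ∘ P?) xs) ≡ length xs
  length-filter+length-filter-¬ P? []       = refl
  length-filter+length-filter-¬ P? (x ∷ xs) with P? x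
  ... | yes _ = cong suc (length-filter+length-filter-¬ P? xs)
  ... | no  _ = trans (+-suc _ _) (cong suc (length-filter+length-filter-¬ P? xs))

module IntegerPolynomial where

  open import Data.Integer using (ℤ; +_; -_; _+_; _-_; _*_; _^_)
  import Data.Integer.Properties as ℤ
  open import Data.Integer.Tactic.RingSolver using (solve-∀)
  open import Data.List using (List; []; _∷_; length)
  open import Data.Nat using (ℕ; zero; suc; pred; NonZero)
  open import Relation.Binary.PropositionalEquality

  eval : List ℤ → ℤ → ℤ
  eval []       x = + 0
  eval (c ∷ cs) x = c + x * eval cs x

  monomial : ℕ → List ℤ
  monomial zero    = + 1 ∷ []
  monomial (suc n) = + 0 ∷ monomial n

  eval-monomial : ∀ n x → eval (monomial n) x ≡ x ^ n
  eval-monomial zero    x = trans (cong (λ t → + 1 + t) (ℤ.*-zeroʳ x)) (ℤ.+-identityʳ (+ 1))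
  eval-monomial (suc n) x = trans (ℤ.+-identityˡ _) (cong (x *_) (eval-monomial n x))

  X^_−1 : ∀ n → .{{NonZero n}} → List ℤ
  X^ suc m −1 = - + 1 ∷ monomial m

  length-X^−1 : ∀ n → .{{_ : NonZero n}} → length (X^ n −1) ≡ suc n
  length-X^−1 (suc m) = cong suc (length-monomial m)
    where
    length-monomial : ∀ n → length (monomial n) ≡ suc n
    length-monomial zero    = refl
    length-monomial (suc n) = cong suc (length-monomial n)

  eval-X^−1 : ∀ n x → .{{_ : NonZero n}} → eval (X^ n −1) x ≡ - + 1 + x ^ n
  eval-X^−1 (suc m) x = cong (λ t → - + 1 + x * t) (eval-monomial m x)

  quotientByLinear : ℤ → List ℤ → List ℤ
  quotientByLinear r []                  = []
  quotientByLinear r (c ∷ [])            = []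
  quotientByLinear r (c ∷ cs@(_ ∷ _)) = eval cs r ∷ quotientByLinear r cs

  length-quotientByLinear : ∀ r f → length (quotientByLinear r f) ≡ pred (length f)
  length-quotientByLinear r []               = refl
  length-quotientByLinear r (c ∷ [])         = refl
  length-quotientByLinear r (c ∷ cs@(_ ∷ _)) = cong suc (length-quotientByLinear r cs)

  eval-quotientByLinear : ∀ r f x → eval f x ≡ (x - r) * eval (quotientByLinear r f) x + eval f r
  eval-quotientByLinear r []               x = nil x r
    where
    nil : ∀ x r → + 0 ≡ (x - r) * + 0 + + 0
    nil = solve-∀
  eval-quotientByLinear r (c ∷ [])         x = constant c x r
    where
    constant : ∀ c x r → c + x * + 0 ≡ (x - r) * + 0 + (c + r * + 0)
    constant = solve-∀
  eval-quotientByLinear r (c ∷ cs@(_ ∷ _)) x =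
    trans (cong (λ g[x] → c + x * g[x]) (eval-quotientByLinear r cs x)) (cons c x r (eval cs r) _)
    where
    cons : ∀ c x r g[r] q[x] →
           c + x * ((x - r) * q[x] + g[r]) ≡ (x - r) * (g[r] + x * q[x]) + (c + r * g[r])
    cons = solve-∀

module Congruence (P : ℕ) where

  open import Data.Nat as ℕ using (zero; suc)
  import Data.Nat.Properties as ℕ
  import Data.Nat.Divisibility as ℕ
  open import Data.Nat.Primality using (Prime; euclidsLemma; ¬prime[1]; prime⇒nonZero)
  open import Data.Nat.ListAction using (sum)
  open import Data.Integer as ℤ using (ℤ; +_; -_; _+_; _-_; _*_; _^_; ∣_∣)
  import Data.Integer.Properties as ℤ
  open import Data.Integer.DivMod using (_%ℕ_; _/ℕ_; n%ℕd<d; a≡a%ℕn+[a/ℕn]*n)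
  open import Data.Integer.Divisibility.Signed
    using (_∣_; divides; _∣?_; ∣ᵤ⇒∣; ∣⇒∣ᵤ; ∣m∣n⇒∣m+n; ∣m⇒∣-m; ∣m⇒∣m*n; ∣n⇒∣m*n)
  open import Data.Integer.Tactic.RingSolver using (solve-∀)
  open import Data.List using (List; []; _∷_; length; filter; map)
  open import Data.List.Membership.Propositional using (_∈_)
  open import Data.List.Membership.Propositional.Properties using (∈-filter⁻)
  open import Data.List.Relation.Unary.Any using (here)
  open import Data.List.Relation.Unary.All as All using (All; []; _∷_)
  import Data.List.Relation.Unary.All.Properties as All
  open import Data.List.Relation.Unary.AllPairs using (AllPairs; []; _∷_)
  import Data.List.Relation.Unary.AllPairs.Properties as AllPairs
  open import Data.Empty using (⊥-elim)
  open import Data.Product using (∃; _,_; _×_)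
  open import Data.Sum using (_⊎_; inj₁; inj₂; [_,_]′)
  open import Function using (id; _∘_)
  open import Relation.Nullary using (¬_; Dec; yes; no; ¬?)
  open import Relation.Nullary.Decidable using (map′)
  open import Relation.Binary.Bundles using (Setoid)
  open import Relation.Binary.PropositionalEquality
  open IntegerPolynomial
  open ListCounting

  infix 4 _≈_ _≉_
  record _≈_ (a b : ℤ) : Set where
    constructor mk≈
    field P∣a-b : + P ∣ a - b
  open _≈_ public

  _≉_ : ℤ → ℤ → Set
  a ≉ b = ¬ a ≈ b

  private
    P∣ : ∀ {m n} → m ≡ n → + P ∣ m → + P ∣ n
    P∣ = subst (+ P ∣_)

  ≈-reflexive : ∀ {a b} → a ≡ b → a ≈ b
  ≈-reflexive {a} refl = mk≈ (divides (+ 0) (ℤ.+-inverseʳ a))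

  ≈-refl : ∀ {a} → a ≈ a
  ≈-refl = ≈-reflexive refl

  ≈-sym : ∀ {a b} → a ≈ b → b ≈ a
  ≈-sym {a} {b} (mk≈ P∣a-b) = mk≈ (P∣ (swap a b) (∣m⇒∣-m P∣a-b))
    where
    swap : ∀ a b → - (a - b) ≡ b - a
    swap = solve-∀

  ≈-trans : ∀ {a b c} → a ≈ b → b ≈ c → a ≈ c
  ≈-trans {a} {b} {c} (mk≈ P∣a-b) (mk≈ P∣b-c) = mk≈ (P∣ (telescope a b c) (∣m∣n⇒∣m+n P∣a-b P∣b-c))
    where
    telescope : ∀ a b c → (a - b) + (b - c) ≡ a - c
    telescope = solve-∀

  ≈-setoid : Setoid _ _
  ≈-setoid = record
    { Carrier = ℤ ; _≈_ = _≈_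
    ; isEquivalence = record { refl = ≈-refl ; sym = ≈-sym ; trans = ≈-trans } }

  infix 4 _≈?_
  _≈?_ : ∀ a b → Dec (a ≈ b)
  a ≈? b = map′ mk≈ P∣a-b (+ P ∣? a - b)

  +-cong : ∀ {a b c d} → a ≈ b → c ≈ d → a + c ≈ b + d
  +-cong {a} {b} {c} {d} (mk≈ P∣a-b) (mk≈ P∣c-d) = mk≈ (P∣ (regroup a b c d) (∣m∣n⇒∣m+n P∣a-b P∣c-d))
    where
    regroup : ∀ a b c d → (a - b) + (c - d) ≡ (a + c) - (b + d)
    regroup = solve-∀

  *-cong : ∀ {a b c d} → a ≈ b → c ≈ d → a * c ≈ b * d
  *-cong {a} {b} {c} {d} (mk≈ P∣a-b) (mk≈ P∣c-d) =
    mk≈ (P∣ (regroup a b c d) (∣m∣n⇒∣m+n (∣m⇒∣m*n c P∣a-b) (∣n⇒∣m*n b P∣c-d)))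
    where
    regroup : ∀ a b c d → (a - b) * c + b * (c - d) ≡ a * c - b * d
    regroup = solve-∀

  ^-cong : ∀ {a b} n → a ≈ b → a ^ n ≈ b ^ n
  ^-cong zero    a≈b = ≈-refl
  ^-cong (suc n) a≈b = *-cong a≈b (^-cong n a≈b)

  ≈0⇒P∣ : ∀ {a} → a ≈ + 0 → + P ∣ a
  ≈0⇒P∣ {a} (mk≈ P∣a-0) = P∣ (ℤ.+-identityʳ a) P∣a-0

  P∣⇒≈0 : ∀ {a} → + P ∣ a → a ≈ + 0
  P∣⇒≈0 {a} P∣a = mk≈ (P∣ (sym (ℤ.+-identityʳ a)) P∣a)

  -≈0⇒≈ : ∀ {a b} → a - b ≈ + 0 → a ≈ b
  -≈0⇒≈ a-b≈0 = mk≈ (≈0⇒P∣ a-b≈0)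

  ≈⇒-≈0 : ∀ {a b} → a ≈ b → a - b ≈ + 0
  ≈⇒-≈0 (mk≈ P∣a-b) = P∣⇒≈0 P∣a-b

  IsZero : List ℤ → Set
  IsZero = All (_≈ + 0)

  IsRoot : List ℤ → ℤ → Set
  IsRoot f x = eval f x ≈ + 0

  Avoids : ℤ → List ℤ → Set
  Avoids x f = ¬ IsZero f → ¬ IsRoot f x

  quotientByLinear-isZero : ∀ r f → IsZero (quotientByLinear r f) → IsRoot f r → IsZero f
  quotientByLinear-isZero r []                  _             _      = []
  quotientByLinear-isZero r (c ∷ [])            _             f[r]≈0 = c≈0 ∷ []
    where
    c≈0 = ≈-trans (≈-reflexive (sym (trans (cong (λ t → c + t) (ℤ.*-zeroʳ r)) (ℤ.+-identityʳ c)))) f[r]≈0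
  quotientByLinear-isZero r (c ∷ cs@(_ ∷ _)) (cs[r]≈0 ∷ q≈0) f[r]≈0 =
    c≈0 ∷ quotientByLinear-isZero r cs q≈0 cs[r]≈0
    where
    open import Relation.Binary.Reasoning.Setoid ≈-setoid
    c≈0 : c ≈ + 0
    c≈0 = begin
      c                ≡⟨ trans (cong (λ t → c + t) (ℤ.*-zeroʳ r)) (ℤ.+-identityʳ c) ⟨
      c + r * + 0      ≈⟨ +-cong (≈-refl {c}) (*-cong (≈-refl {r}) cs[r]≈0) ⟨
      c + r * eval cs r ≈⟨ f[r]≈0 ⟩
      + 0              ∎

  module Field (P-prime : Prime P) where

    instance
      P-nonZero : ℕ.NonZero P
      P-nonZero = prime⇒nonZero P-prime

    ≈0-split : ∀ {a b} → a * b ≈ + 0 → a ≈ + 0 ⊎ b ≈ + 0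
    ≈0-split {a} {b} ab≈0
      with euclidsLemma ∣ a ∣ ∣ b ∣ P-prime (subst (P ℕ.∣_) (ℤ.abs-* a b) (∣⇒∣ᵤ (≈0⇒P∣ ab≈0)))
    ... | inj₁ P∣a = inj₁ (P∣⇒≈0 (∣ᵤ⇒∣ P∣a))
    ... | inj₂ P∣b = inj₂ (P∣⇒≈0 (∣ᵤ⇒∣ P∣b))

    1≉0 : + 1 ≉ + 0
    1≉0 1≈0 = ¬prime[1] (subst Prime (ℕ.∣1⇒≡1 (∣⇒∣ᵤ (≈0⇒P∣ 1≈0))) P-prime)

    *-≉0 : ∀ {a b} → a ≉ + 0 → b ≉ + 0 → a * b ≉ + 0
    *-≉0 a≉0 b≉0 ab≈0 = [ a≉0 , b≉0 ]′ (≈0-split ab≈0)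

    ^-≉0 : ∀ {a} n → a ≉ + 0 → a ^ n ≉ + 0
    ^-≉0 zero    a≉0 = 1≉0
    ^-≉0 (suc n) a≉0 = *-≉0 a≉0 (^-≉0 n a≉0)

    *-cancelˡ-≈ : ∀ {c a b} → c ≉ + 0 → c * a ≈ c * b → a ≈ b
    *-cancelˡ-≈ {c} {a} {b} c≉0 ca≈cb =
      [ (λ c≈0 → ⊥-elim (c≉0 c≈0)) , -≈0⇒≈ ]′
        (≈0-split (≈-trans (≈-reflexive (factor c a b)) (≈⇒-≈0 ca≈cb)))
      where
      factor : ∀ c a b → c * (a - b) ≡ c * a - c * b
      factor = solve-∀

    <⇒≉ : ∀ {k l} → k ℕ.< l → l ℕ.< P → + k ≉ + l
    <⇒≉ {k} {l} k<l l<P (mk≈ P∣k-l) =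
      ℕ.<⇒≱ (ℕ.≤-<-trans (ℕ.m∸n≤m l k) l<P) (ℕ.∣⇒≤ {{ℕ.>-nonZero (ℕ.m<n⇒0<n∸m k<l)}} P∣l∸k)
      where
      P∣l∸k : P ℕ.∣ l ℕ.∸ k
      P∣l∸k = subst (P ℕ.∣_) (trans (cong ∣_∣ (ℤ.[+m]-[+n]≡m⊖n k l)) (ℤ.∣⊖∣-< k<l)) (∣⇒∣ᵤ P∣k-l)

    residue : ℤ → ℕ
    residue a = a %ℕ P

    residue<P : ∀ a → residue a ℕ.< P
    residue<P a = n%ℕd<d a P

    ≈residue : ∀ a → a ≈ + residue a
    ≈residue a = mk≈ (divides (a /ℕ P) (shift a (+ residue a) (a /ℕ P) (a≡a%ℕn+[a/ℕn]*n a P)))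
      where
      shift : ∀ a r q → a ≡ r + q * + P → a - r ≡ q * + P
      shift a r q refl = cancel r (q * + P)
        where
        cancel : ∀ r s → r + s - r ≡ s
        cancel = solve-∀

    0<residue : ∀ {a} → a ≉ + 0 → 0 ℕ.< residue a
    0<residue {a} a≉0 = ℕ.n≢0⇒n>0 (λ r≡0 → a≉0 (≈-trans (≈residue a) (≈-reflexive (cong +_ r≡0))))

    root⇒root-quotientByLinear : ∀ {r b} f → IsRoot f r → r ≉ b → IsRoot f b → IsRoot (quotientByLinear r f) b
    root⇒root-quotientByLinear {r} {b} f f[r]≈0 r≉b f[b]≈0 =
      [ (λ b-r≈0 → ⊥-elim (r≉b (≈-sym (-≈0⇒≈ b-r≈0)))) , id ]′ (≈0-split (begin
        (b - r) * q[b]              ≡⟨ ℤ.+-identityʳ _ ⟨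
        (b - r) * q[b] + + 0        ≈⟨ +-cong (≈-refl {(b - r) * q[b]}) f[r]≈0 ⟨
        (b - r) * q[b] + eval f r   ≡⟨ eval-quotientByLinear r f b ⟨
        eval f b                    ≈⟨ f[b]≈0 ⟩
        + 0                         ∎))
      where
      open import Relation.Binary.Reasoning.Setoid ≈-setoid
      q[b] = eval (quotientByLinear r f) b

    roots<length : ∀ f {rs} → ¬ IsZero f → AllPairs _≉_ rs → All (IsRoot f) rs → length rs ℕ.< length f
    roots<length []        f≉0 _ _ = ⊥-elim (f≉0 [])
    roots<length (_ ∷ _) {[]} _ _ _ = ℕ.z<s
    roots<length f@(_ ∷ _) {r ∷ rs} f≉0 (r≉rs ∷ rs-distinct) (f[r]≈0 ∷ rs-roots) =
      ℕ.s<s (subst (length rs ℕ.<_) (length-quotientByLinear r f)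
        (roots<length q (λ q≈0 → f≉0 (quotientByLinear-isZero r f q≈0 f[r]≈0)) rs-distinct
          (All.zipWith (λ (r≉b , f[b]≈0) → root⇒root-quotientByLinear f f[r]≈0 r≉b f[b]≈0) (r≉rs , rs-roots))))
      where
      q = quotientByLinear r f

    -- a nonzero f has fewer than length f roots, so at most Σ length fs elements of xs are bad
    ∃-avoiding : ∀ fs {xs} → AllPairs _≉_ xs → sum (map length fs) ℕ.< length xs →
                 ∃ λ x → x ∈ xs × All (Avoids x) fs
    ∃-avoiding []       {x ∷ _} _ _ = x , here refl , []
    ∃-avoiding (f ∷ fs) {xs} xs-distinct budget with All.all? (_≈? + 0) f
    ... | yes f≈0 =
      let x , x∈xs , x-avoids = ∃-avoiding fs xs-distinct (ℕ.<-≤-trans (ℕ.s≤s (ℕ.m≤n+m _ (length f))) budget)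
      in  x , x∈xs , (λ f≉0 → ⊥-elim (f≉0 f≈0)) ∷ x-avoids
    ... | no f≉0 =
      let x , x∈ys , x-avoids = ∃-avoiding fs (AllPairs.filter⁺ (¬? ∘ root?) xs-distinct) Σfs<#ys
          x∈xs , x-nonroot = ∈-filter⁻ (¬? ∘ root?) {xs = xs} x∈ys
      in  x , x∈xs , (λ _ → x-nonroot) ∷ x-avoids
      where
      root? = λ x → eval f x ≈? + 0
      #roots<length-f : length (filter root? xs) ℕ.< length f
      #roots<length-f = roots<length f f≉0 (AllPairs.filter⁺ root? xs-distinct) (All.all-filter root? xs)
      Σfs<#ys : sum (map length fs) ℕ.< length (filter (¬? ∘ root?) xs)
      Σfs<#ys = ℕ.+-cancelˡ-< (length f) _ _ (begin-strict
        length f ℕ.+ sum (map length fs)                               <⟨ budget ⟩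
        length xs                                                       ≡⟨ length-filter+length-filter-¬ root? xs ⟨
        length (filter root? xs) ℕ.+ length (filter (¬? ∘ root?) xs)  <⟨ ℕ.+-monoˡ-< _ #roots<length-f ⟩
        length f ℕ.+ length (filter (¬? ∘ root?) xs)                   ∎)
        where open ℕ.≤-Reasoning

module MultiplicativeOrder (P : ℕ) where

  open import Data.Nat as ℕ using (zero; suc)
  import Data.Nat.Properties as ℕ
  import Data.Nat.Divisibility as ℕ
  import Data.Nat.Tactic.RingSolver as ℕ-Solver
  open import Data.Nat.DivMod using (_%_; _/_; m%n<n; m≡m%n+[m/n]*n)
  open import Data.Nat.Primality using (Prime; prime⇒nonTrivial)
  open import Data.Nat.Coprimality using (Coprime; coprime-divisor) renaming (sym to Coprime-sym)
  open import Data.Nat.ListAction using (sum)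
  open import Data.Integer as ℤ using (ℤ; +_; -_; _+_; _*_; _^_)
  import Data.Integer.Properties as ℤ
  open import Data.Integer.Tactic.RingSolver using (solve-∀)
  open import Data.Fin using (Fin; toℕ; fromℕ<)
  open import Data.Fin.Properties using (toℕ-fromℕ<; toℕ<n; pigeonhole)
  open import Data.List using (List; []; _∷_; length; map; applyUpTo)
  open import Data.List.Properties using (length-applyUpTo)
  open import Data.List.Extrema.Nat using (argmax; argmax-all; f[xs]≤f[argmax])
  open import Data.List.Membership.Propositional using (_∈_)
  open import Data.List.Membership.Propositional.Properties using (∈-applyUpTo⁺; ∈-applyUpTo⁻)
  open import Data.List.Relation.Unary.All as All using (All; []; _∷_)
  import Data.List.Relation.Unary.All.Properties as All
  open import Data.List.Relation.Unary.AllPairs using (AllPairs)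
  import Data.List.Relation.Unary.AllPairs.Properties as AllPairs
  open import Data.Empty using (⊥-elim)
  open import Data.Product using (∃; ∃₂; _,_; _×_; proj₁; proj₂)
  open import Relation.Nullary using (¬_; yes; no)
  open import Relation.Nullary.Decidable using (_×-dec_)
  open import Relation.Binary.PropositionalEquality
  open NatArithmetic
  open IntegerPolynomial
  open Congruence P

  ^-distribʳ-* : ∀ x y n → (x * y) ^ n ≡ x ^ n * y ^ n
  ^-distribʳ-* x y zero    = refl
  ^-distribʳ-* x y (suc n) = trans (cong (x * y *_) (^-distribʳ-* x y n)) (interchange x y (x ^ n) (y ^ n))
    where
    interchange : ∀ x y a b → x * y * (a * b) ≡ x * a * (y * b)
    interchange = solve-∀

  *≈1-cancelʳ : ∀ {a b} → a * b ≈ + 1 → b ≈ + 1 → a ≈ + 1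
  *≈1-cancelʳ {a} {b} ab≈1 b≈1 =
    ≈-trans (≈-reflexive (sym (ℤ.*-identityʳ a))) (≈-trans (*-cong (≈-refl {a}) (≈-sym b≈1)) ab≈1)

  *≈1-cancelˡ : ∀ {a b} → a * b ≈ + 1 → a ≈ + 1 → b ≈ + 1
  *≈1-cancelˡ {a} {b} ab≈1 = *≈1-cancelʳ (≈-trans (≈-reflexive (ℤ.*-comm b a)) ab≈1)

  ^≈1⇒^*≈1 : ∀ {x s k} → x ^ s ≈ + 1 → s ℕ.∣ k → x ^ k ≈ + 1
  ^≈1⇒^*≈1 {x} {s} x^s≈1 (ℕ.divides q refl) = begin
    x ^ (q ℕ.* s)  ≡⟨ cong (x ^_) (ℕ.*-comm q s) ⟩
    x ^ (s ℕ.* q)  ≡⟨ ℤ.^-*-assoc x s q ⟨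
    (x ^ s) ^ q    ≈⟨ ^-cong q x^s≈1 ⟩
    (+ 1) ^ q      ≡⟨ ℤ.^-zeroˡ q ⟩
    + 1            ∎
    where open import Relation.Binary.Reasoning.Setoid ≈-setoid

  record HasOrder (x : ℤ) (s : ℕ) : Set where
    field
      order-nonZero : ℕ.NonZero s
      ^≈1⇒∣         : ∀ {k} → x ^ k ≈ + 1 → s ℕ.∣ k
      ∣⇒^≈1         : ∀ {k} → s ℕ.∣ k → x ^ k ≈ + 1
  open HasOrder public

  hasOrder : ∀ {x s} → ℕ.NonZero s → x ^ s ≈ + 1 → (∀ {k} → x ^ k ≈ + 1 → s ℕ.∣ k) → HasOrder x s
  hasOrder s≢0 x^s≈1 minimal = record
    { order-nonZero = s≢0 ; ^≈1⇒∣ = minimal ; ∣⇒^≈1 = ^≈1⇒^*≈1 x^s≈1 }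

  least⇒HasOrder : ∀ {x s} → 0 ℕ.< s → x ^ s ≈ + 1 → (∀ {k} → k ℕ.< s → ¬ (0 ℕ.< k × x ^ k ≈ + 1)) →
                   HasOrder x s
  least⇒HasOrder {x} {s} 0<s x^s≈1 minimal = hasOrder (ℕ.>-nonZero 0<s) x^s≈1 s∣
    where
    instance _ = ℕ.>-nonZero 0<s
    s∣ : ∀ {k} → x ^ k ≈ + 1 → s ℕ.∣ k
    s∣ {k} x^k≈1 with k % s in k%s≡
    ... | zero  = ℕ.m%n≡0⇒n∣m k s k%s≡
    ... | suc r =
      ⊥-elim (minimal (subst (ℕ._< s) k%s≡ (m%n<n k s)) (ℕ.z<s , subst (λ t → x ^ t ≈ + 1) k%s≡ x^[k%s]≈1))
      where
      x^[k%s]≈1 : x ^ (k % s) ≈ + 1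
      x^[k%s]≈1 = *≈1-cancelʳ
        (≈-trans (≈-reflexive (trans (sym (ℤ.^-distribˡ-+-* x (k % s) _)) (cong (x ^_) (sym (m≡m%n+[m/n]*n k s)))))
                 x^k≈1)
        (^≈1⇒^*≈1 x^s≈1 (ℕ.n∣m*n (k / s)))

  HasOrder-unique : ∀ {x s t} → HasOrder x s → HasOrder x t → s ≡ t
  HasOrder-unique ord-s ord-t =
    ℕ.∣-antisym (^≈1⇒∣ ord-s (∣⇒^≈1 ord-t ℕ.∣-refl)) (^≈1⇒∣ ord-t (∣⇒^≈1 ord-s ℕ.∣-refl))

  HasOrder-resp-≈ : ∀ {x y s} → x ≈ y → HasOrder x s → HasOrder y s
  HasOrder-resp-≈ {x} {y} {s} x≈y ord = hasOrder (order-nonZero ord)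
    (≈-trans (^-cong s (≈-sym x≈y)) (∣⇒^≈1 ord ℕ.∣-refl))
    (λ {k} y^k≈1 → ^≈1⇒∣ ord (≈-trans (^-cong k x≈y) y^k≈1))

  HasOrder-^ : ∀ {x} a {b} → HasOrder x (a ℕ.* b) → HasOrder (x ^ a) b
  HasOrder-^ {x} a {b} ord = hasOrder (ℕ.m*n≢0⇒n≢0 a)
    (≈-trans (≈-reflexive (ℤ.^-*-assoc x a b)) (∣⇒^≈1 ord ℕ.∣-refl))
    (λ {k} x^a^k≈1 → ℕ.*-cancelˡ-∣ a {{ℕ.m*n≢0⇒m≢0 a}}
       (^≈1⇒∣ ord (≈-trans (≈-reflexive (sym (ℤ.^-*-assoc x a k))) x^a^k≈1)))
    where instance _ = order-nonZero ord

  HasOrder-^-coprime : ∀ {x n u} → HasOrder x n → Coprime u n → HasOrder (x ^ u) n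
  HasOrder-^-coprime {x} {n} {u} ord u⊥n = hasOrder (order-nonZero ord)
    (≈-trans (≈-reflexive (ℤ.^-*-assoc x u n)) (∣⇒^≈1 ord (ℕ.n∣m*n u)))
    (λ {k} x^u^k≈1 → coprime-divisor (Coprime-sym u⊥n)
       (^≈1⇒∣ ord (≈-trans (≈-reflexive (sym (ℤ.^-*-assoc x u k))) x^u^k≈1)))

  HasOrder-* : ∀ {x y s t} → HasOrder x s → HasOrder y t → Coprime s t → HasOrder (x * y) (s ℕ.* t)
  HasOrder-* {x} {y} {s} {t} ord-x ord-y s⊥t = hasOrder (ℕ.m*n≢0 s t)
    (≈-trans (≈-reflexive (^-distribʳ-* x y (s ℕ.* t)))
             (*-cong (∣⇒^≈1 ord-x (ℕ.m∣m*n t)) (∣⇒^≈1 ord-y (ℕ.n∣m*n s))))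
    (λ (xy^k≈1) → coprime⇒*∣ s⊥t (s∣k xy^k≈1) (t∣k xy^k≈1))
    where
    instance
      _ = order-nonZero ord-x
      _ = order-nonZero ord-y
    -- raising (x y)^k ≈ 1 to the power t (resp. s) kills y (resp. x)
    s∣k : ∀ {k} → (x * y) ^ k ≈ + 1 → s ℕ.∣ k
    s∣k {k} xy^k≈1 = coprime-divisor s⊥t (^≈1⇒∣ ord-x (*≈1-cancelʳ
      (≈-trans (≈-reflexive (sym (^-distribʳ-* x y (t ℕ.* k)))) (^≈1⇒^*≈1 xy^k≈1 (ℕ.n∣m*n t)))
      (∣⇒^≈1 ord-y (ℕ.m∣m*n k))))
    t∣k : ∀ {k} → (x * y) ^ k ≈ + 1 → t ℕ.∣ k
    t∣k {k} xy^k≈1 = coprime-divisor (Coprime-sym s⊥t) (^≈1⇒∣ ord-y (*≈1-cancelˡ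
      (≈-trans (≈-reflexive (sym (^-distribʳ-* x y (s ℕ.* k)))) (^≈1⇒^*≈1 xy^k≈1 (ℕ.n∣m*n s)))
      (∣⇒^≈1 ord-x (ℕ.m∣m*n k))))

  ∃-larger-order : ∀ {x y M t} → HasOrder x M → HasOrder y t → ¬ t ℕ.∣ M →
                   ∃₂ λ z M₂ → HasOrder z M₂ × M ℕ.< M₂
  ∃-larger-order {x} {y} {M} {t} ord-x ord-y t∤M =
    x ^ (r ℕ.^ a) * y ^ t' , M' ℕ.* r ℕ.^ e ,
    HasOrder-* (HasOrder-^ (r ℕ.^ a) (subst (HasOrder x) M≡ ord-x))
               (HasOrder-^ t' (subst (HasOrder y) (trans t≡ (ℕ.*-comm (r ℕ.^ e) t')) ord-y))
               (coprime-^ʳ e (∤-prime⇒coprime r-prime r∤M')) ,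
    subst (ℕ._< M' ℕ.* r ℕ.^ e) (trans (ℕ.*-comm M' (r ℕ.^ a)) (sym M≡))
      (ℕ.*-monoʳ-< M' (ℕ.^-monoʳ-< r (ℕ.nonTrivial⇒n>1 r {{prime⇒nonTrivial r-prime}}) a<e))
    where
    instance
      _ = order-nonZero ord-x
      _ = order-nonZero ord-y
    open PrimePowerGap (∤⇒primePowerGap t∤M)
    instance _ = ℕ.m*n≢0⇒n≢0 (r ℕ.^ a) {{subst ℕ.NonZero M≡ (order-nonZero ord-x)}}

  module _ (P-prime : Prime P) where

    open Field P-prime

    P∸1<P : P ℕ.∸ 1 ℕ.< P
    P∸1<P = ℕ.∸-monoʳ-< ℕ.z<s (ℕ.>-nonZero⁻¹ P)

    HasOrder⇒≉0 : ∀ {x s} → HasOrder x s → x ≉ + 0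
    HasOrder⇒≉0 {x} {s} ord x≈0 = 1≉0 (begin
      + 1        ≈⟨ ∣⇒^≈1 ord ℕ.∣-refl ⟨
      x ^ s      ≈⟨ ^-cong s x≈0 ⟩
      (+ 0) ^ s  ≡⟨ 0^s≡0 s {{order-nonZero ord}} ⟩
      + 0        ∎)
      where
      open import Relation.Binary.Reasoning.Setoid ≈-setoid
      0^s≡0 : ∀ s → .{{ℕ.NonZero s}} → (+ 0) ^ s ≡ + 0
      0^s≡0 (suc s) = refl

    ^≈^⇒^∸≈1 : ∀ {x i j} → x ≉ + 0 → i ℕ.≤ j → x ^ i ≈ x ^ j → x ^ (j ℕ.∸ i) ≈ + 1
    ^≈^⇒^∸≈1 {x} {i} {j} x≉0 i≤j x^i≈x^j = ≈-sym (*-cancelˡ-≈ (^-≉0 i x≉0) (begin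
      x ^ i * + 1            ≡⟨ ℤ.*-identityʳ (x ^ i) ⟩
      x ^ i                  ≈⟨ x^i≈x^j ⟩
      x ^ j                  ≡⟨ cong (x ^_) (ℕ.m+[n∸m]≡n i≤j) ⟨
      x ^ (i ℕ.+ (j ℕ.∸ i))  ≡⟨ ℤ.^-distribˡ-+-* x i (j ℕ.∸ i) ⟩
      x ^ i * x ^ (j ℕ.∸ i)  ∎))
      where open import Relation.Binary.Reasoning.Setoid ≈-setoid

    -- the nonzero residues 1, …, P - 1, shifted down to 0, …, P - 2
    unitIndex : ∀ a → a ≉ + 0 → Fin (P ℕ.∸ 1)
    unitIndex a a≉0 = fromℕ< (ℕ.∸-monoˡ-< (residue<P a) (0<residue a≉0))

    unitIndex-injective : ∀ {a b} a≉0 b≉0 → unitIndex a a≉0 ≡ unitIndex b b≉0 → a ≈ b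
    unitIndex-injective {a} {b} a≉0 b≉0 eq =
      ≈-trans (≈residue a) (≈-trans (≈-reflexive (cong +_ residue≡)) (≈-sym (≈residue b)))
      where
      residue≡ : residue a ≡ residue b
      residue≡ = ℕ.∸-cancelʳ-≡ (0<residue a≉0) (0<residue b≉0)
        (trans (sym (toℕ-fromℕ< _)) (trans (cong toℕ eq) (toℕ-fromℕ< _)))

    -- pigeonhole on the P powers x ^ 0, …, x ^ (P - 1), which are nonzero
    ∃-^≈1 : ∀ {x} → x ≉ + 0 → ∃ λ k → 0 ℕ.< k × k ℕ.≤ P ℕ.∸ 1 × x ^ k ≈ + 1
    ∃-^≈1 {x} x≉0 with pigeonhole P∸1<P (λ i → unitIndex (x ^ toℕ i) (^-≉0 (toℕ i) x≉0))
    ... | i , j , i<j , eq =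
      toℕ j ℕ.∸ toℕ i , ℕ.m<n⇒0<n∸m i<j , ℕ.≤-trans (ℕ.m∸n≤m (toℕ j) (toℕ i)) (ℕ.∸-monoˡ-≤ 1 (toℕ<n j)) ,
      ^≈^⇒^∸≈1 x≉0 (ℕ.<⇒≤ i<j) (unitIndex-injective (^-≉0 (toℕ i) x≉0) (^-≉0 (toℕ j) x≉0) eq)

    ∃-order : ∀ {x} → x ≉ + 0 → ∃ λ s → HasOrder x s × s ℕ.≤ P ℕ.∸ 1
    ∃-order {x} x≉0 =
      let k , 0<k , k≤P∸1 , x^k≈1 = ∃-^≈1 x≉0
          s , (0<s , x^s≈1) , s≤k , minimal = ∃-least (λ k → 0 ℕ.<? k ×-dec x ^ k ≈? + 1) (0<k , x^k≈1)
      in  s , least⇒HasOrder 0<s x^s≈1 minimal , ℕ.≤-trans s≤k k≤P∸1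

    order : ℤ → ℕ
    order x with x ≈? + 0
    ... | yes _   = 0
    ... | no x≉0 = proj₁ (∃-order x≉0)

    order-hasOrder : ∀ {x} → x ≉ + 0 → HasOrder x (order x)
    order-hasOrder {x} x≉0 with x ≈? + 0
    ... | yes x≈0  = ⊥-elim (x≉0 x≈0)
    ... | no  x≉0′ = proj₁ (proj₂ (∃-order x≉0′))

    order≤P∸1 : ∀ x → order x ℕ.≤ P ℕ.∸ 1
    order≤P∸1 x with x ≈? + 0
    ... | yes _   = ℕ.z≤n
    ... | no x≉0 = proj₂ (proj₂ (∃-order x≉0))

    units : List ℤ
    units = applyUpTo (λ k → + suc k) (P ℕ.∸ 1)

    private
      1+k<P : ∀ {k} → k ℕ.< P ℕ.∸ 1 → suc k ℕ.< P
      1+k<P {k} k<P∸1 = subst (ℕ._≤ P) (ℕ.+-comm (suc k) 1) (ℕ.m≤o∸n⇒m+n≤o (suc k) (ℕ.>-nonZero⁻¹ P) k<P∸1)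

    units-distinct : AllPairs _≉_ units
    units-distinct = AllPairs.applyUpTo⁺₁ _ (P ℕ.∸ 1) (λ i<j j<P∸1 → <⇒≉ (ℕ.s<s i<j) (1+k<P j<P∸1))

    units-≉0 : All (_≉ + 0) units
    units-≉0 = All.applyUpTo⁺₁ _ (P ℕ.∸ 1) (λ k<P∸1 → ≉-sym (<⇒≉ ℕ.z<s (1+k<P k<P∸1)))
      where
      ≉-sym : ∀ {a b} → a ≉ b → b ≉ a
      ≉-sym a≉b b≈a = a≉b (≈-sym b≈a)

    residue∈units : ∀ {a} → a ≉ + 0 → + residue a ∈ units
    residue∈units {a} a≉0 with residue a | 0<residue a≉0 | residue<P a
    ... | suc r | _ | r<P = ∈-applyUpTo⁺ _ (ℕ.∸-monoˡ-< r<P (ℕ.s≤s ℕ.z≤n))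

    ¬IsZero-X^−1 : ∀ n → .{{_ : ℕ.NonZero n}} → ¬ IsZero (X^ n −1)
    ¬IsZero-X^−1 (suc m) (_ ∷ monomial≈0) = ¬IsZero-monomial m monomial≈0
      where
      ¬IsZero-monomial : ∀ n → ¬ IsZero (monomial n)
      ¬IsZero-monomial zero    (1≈0 ∷ []) = 1≉0 1≈0
      ¬IsZero-monomial (suc n) (_ ∷ zs)   = ¬IsZero-monomial n zs

    -- an element g of maximal order M: every order divides M, so all P - 1 units are roots of X^M - 1
    primitiveRoot : ∃ λ g → HasOrder g (P ℕ.∸ 1)
    primitiveRoot = g , subst (HasOrder g) M≡P∸1 ord-g
      where
      g = argmax order (+ 1) units
      M = order g
      ord-g : HasOrder g M
      ord-g = order-hasOrder (argmax-all order 1≉0 units-≉0)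
      instance _ = order-nonZero ord-g

      orders∣M : ∀ {y t} → HasOrder y t → t ℕ.∣ M
      orders∣M {y} {t} ord-y with t ℕ.∣? M
      ... | yes t∣M = t∣M
      ... | no  t∤M =
        let z , M₂ , ord-z , M<M₂ = ∃-larger-order ord-g ord-y t∤M
            z≉0 = HasOrder⇒≉0 ord-z
            order≡M₂ = HasOrder-unique (order-hasOrder (All.lookup units-≉0 (residue∈units z≉0)))
                                       (HasOrder-resp-≈ (≈residue z) ord-z)
        in  ⊥-elim (ℕ.<⇒≱ M<M₂ (subst (ℕ._≤ M) order≡M₂
              (All.lookup (f[xs]≤f[argmax] {f = order} (+ 1) units) (residue∈units z≉0))))

      units-roots : All (IsRoot (X^ M −1)) units
      units-roots = All.map (λ {y} y≉0 → begin
        eval (X^ M −1) y  ≡⟨ eval-X^−1 M y ⟩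
        - + 1 + y ^ M     ≈⟨ +-cong (≈-refl { - + 1}) (∣⇒^≈1 (order-hasOrder y≉0) (orders∣M (order-hasOrder y≉0))) ⟩
        - + 1 + + 1       ≡⟨⟩
        + 0               ∎) units-≉0
        where open import Relation.Binary.Reasoning.Setoid ≈-setoid

      M≡P∸1 : M ≡ P ℕ.∸ 1
      M≡P∸1 = ℕ.≤-antisym (order≤P∸1 g) (ℕ.s≤s⁻¹ (subst₂ ℕ._<_ (length-applyUpTo _ (P ℕ.∸ 1)) (length-X^−1 M)
        (roots<length (X^ M −1) (¬IsZero-X^−1 M) units-distinct units-roots)))

    ^≈^⇒order∣∸ : ∀ {x n i j} → HasOrder x n → i ℕ.≤ j → x ^ i ≈ x ^ j → n ℕ.∣ j ℕ.∸ i
    ^≈^⇒order∣∸ ord i≤j x^i≈x^j = ^≈1⇒∣ ord (^≈^⇒^∸≈1 (HasOrder⇒≉0 ord) i≤j x^i≈x^j)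

    -- The candidates g ^ (1 + t J s), t < J, are primitive roots (s being the part of C coprime
    -- to J), and their C-th powers are pairwise distinct, so one of them avoids the roots of fs.
    ∃-primitiveRoot-avoiding : ∀ {C J} → C ℕ.* (J ℕ.* J) ≡ P ℕ.∸ 1 → ∀ fs → sum (map length fs) ℕ.< J →
                               ∃ λ ε → HasOrder ε (P ℕ.∸ 1) × All (Avoids (ε ^ C)) fs
    ∃-primitiveRoot-avoiding {C} {J} CJ²≡P∸1 fs budget =
      let x , x∈βs , x-avoids = ∃-avoiding fs (AllPairs.applyUpTo⁺₁ β J β-distinct)
                                   (subst (sum (map length fs) ℕ.<_) (sym (length-applyUpTo β J)) budget)
          t , _ , x≡β[t] = ∈-applyUpTo⁻ β x∈βs
      in  ε t , HasOrder-^-coprime ord-g (u-coprime t) , subst (λ y → All (Avoids y) fs) x≡β[t] x-avoids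
      where
      g = proj₁ primitiveRoot
      ord-g = proj₂ primitiveRoot
      instance
        CJ²-nonZero : ℕ.NonZero (C ℕ.* (J ℕ.* J))
        CJ²-nonZero = subst ℕ.NonZero (sym CJ²≡P∸1) (order-nonZero ord-g)
        C-nonZero = ℕ.m*n≢0⇒m≢0 C
        J-nonZero = ℕ.m*n≢0⇒m≢0 J {{ℕ.m*n≢0⇒n≢0 C}}
        CJ-nonZero = ℕ.m*n≢0 C J
      open CoprimePart (coprimePart C J)
      u : ℕ → ℕ
      u t = suc (t ℕ.* (J ℕ.* s))
      ε β : ℕ → ℤ
      ε t = g ^ u t
      β t = ε t ^ C

      u-coprime : ∀ t → Coprime (u t) (P ℕ.∸ 1)
      u-coprime t = subst (Coprime (u t)) CJ²≡P∸1 (coprime-*ʳ u⊥C (coprime-*ʳ u⊥J u⊥J))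
        where
        u⊥J = ∣⇒coprime-1+ (ℕ.∣n⇒∣m*n t (ℕ.m∣m*n s))
        u⊥s = ∣⇒coprime-1+ (ℕ.∣n⇒∣m*n t (ℕ.n∣m*n J))
        u⊥C = subst (Coprime (u t)) (sym C≡s*S) (coprime-*ʳ u⊥s (coprime⇒coprime-S u⊥J))

      -- β a ≈ β b forces C J² ∣ (b - a) J s C, i.e. J ∣ (b - a) s, so J ∣ b - a
      β-distinct : ∀ {a b} → a ℕ.< b → b ℕ.< J → β a ≉ β b
      β-distinct {a} {b} a<b b<J βa≈βb = ℕ.<⇒≱ (ℕ.≤-<-trans (ℕ.m∸n≤m b a) b<J)
        (ℕ.∣⇒≤ {{ℕ.>-nonZero (ℕ.m<n⇒0<n∸m a<b)}} (coprime-divisor (Coprime-sym s-coprime) J∣s*[b∸a]))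
        where
        d = b ℕ.∸ a
        uC[b]≡ : u b ℕ.* C ≡ u a ℕ.* C ℕ.+ d ℕ.* (J ℕ.* s) ℕ.* C
        uC[b]≡ = trans (cong (λ t → u t ℕ.* C) (sym (ℕ.m+[n∸m]≡n (ℕ.<⇒≤ a<b)))) (expand a d (J ℕ.* s) C)
          where
          expand : ∀ a d K C → suc ((a ℕ.+ d) ℕ.* K) ℕ.* C ≡ suc (a ℕ.* K) ℕ.* C ℕ.+ d ℕ.* K ℕ.* C
          expand = ℕ-Solver.solve-∀
        CJ²∣ : C ℕ.* (J ℕ.* J) ℕ.∣ d ℕ.* (J ℕ.* s) ℕ.* C
        CJ²∣ = subst₂ ℕ._∣_ (sym CJ²≡P∸1) (trans (cong (ℕ._∸ u a ℕ.* C) uC[b]≡) (ℕ.m+n∸m≡n (u a ℕ.* C) _))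
          (^≈^⇒order∣∸ ord-g (subst (u a ℕ.* C ℕ.≤_) (sym uC[b]≡) (ℕ.m≤m+n _ _))
            (≈-trans (≈-reflexive (sym (ℤ.^-*-assoc g (u a) C)))
                     (≈-trans βa≈βb (≈-reflexive (ℤ.^-*-assoc g (u b) C)))))
        J∣s*[b∸a] : J ℕ.∣ s ℕ.* d
        J∣s*[b∸a] = ℕ.*-cancelˡ-∣ (C ℕ.* J) (subst₂ ℕ._∣_ (regroup₁ C J) (regroup₂ C J s d) CJ²∣)
          where
          regroup₁ : ∀ C J → C ℕ.* (J ℕ.* J) ≡ C ℕ.* J ℕ.* J
          regroup₁ = ℕ-Solver.solve-∀
          regroup₂ : ∀ C J s d → d ℕ.* (J ℕ.* s) ℕ.* C ≡ C ℕ.* J ℕ.* (s ℕ.* d)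
          regroup₂ = ℕ-Solver.solve-∀

module Enumeration where

  open import Data.Nat using (ℕ; zero; suc; _+_)
  open import Data.Nat.Properties using (+-suc; +-identityʳ)
  open import Data.Integer as ℤ using (ℤ; +_; -[1+_])
  import Data.Integer.Properties as ℤ
  open import Data.List using (List; length)
  open import Data.Vec using (Vec; []; _∷_; toList; fromList)
  open import Data.Vec.Properties using (toList∘fromList)
  open import Data.Product using (Σ; ∃; _×_; _,_; proj₁; proj₂; uncurry)
  open import Function using (_∘_)
  open import Function.Definitions using (StrictlySurjective)
  open import Relation.Binary.PropositionalEquality

  Enumeration : Set → Set
  Enumeration A = Σ (ℕ → A) (StrictlySurjective _≡_)

  private
    next : ℕ × ℕ → ℕ × ℕ
    next (zero  , b) = suc b , 0
    next (suc a , b) = a , suc b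

  -- Cantor's zigzag through ℕ × ℕ
  unpair : ℕ → ℕ × ℕ
  unpair zero    = 0 , 0
  unpair (suc n) = next (unpair n)

  unpair-walk : ∀ b {n a c} → unpair n ≡ (b + a , c) → unpair (b + n) ≡ (a , b + c)
  unpair-walk zero    eq = eq
  unpair-walk (suc b) {n} {a} {c} eq
    rewrite unpair-walk b {n} {suc a} {c} (trans eq (cong (_, c) (sym (+-suc b a)))) = refl

  unpair-diagonal : ∀ s → ∃ λ n → unpair n ≡ (s , 0)
  unpair-diagonal zero    = 0 , refl
  unpair-diagonal (suc s) =
    let n , eq = unpair-diagonal s
    in  suc (s + n) , cong next (trans (unpair-walk s (trans eq (cong (_, 0) (sym (+-identityʳ s)))))
                                       (cong (0 ,_) (+-identityʳ s)))

  unpair-surjective : StrictlySurjective _≡_ unpair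
  unpair-surjective (a , b) =
    let n , eq = unpair-diagonal (b + a)
    in  b + n , trans (unpair-walk b eq) (cong (a ,_) (+-identityʳ b))

  enumerate-map : ∀ {A B : Set} (f : A → B) → StrictlySurjective _≡_ f → Enumeration A → Enumeration B
  enumerate-map f f-surjective (e , e-surjective) = f ∘ e , λ b →
    let a , fa≡b = f-surjective b
        n , en≡a = e-surjective a
    in  n , trans (cong f en≡a) fa≡b

  enumerate-× : ∀ {A B : Set} → Enumeration A → Enumeration B → Enumeration (A × B)
  enumerate-× (e , e-surjective) (e′ , e′-surjective) =
    (λ n → e (proj₁ (unpair n)) , e′ (proj₂ (unpair n))) , λ (a , b) →
      let i , ei≡a  = e-surjective a
          j , e′j≡b = e′-surjective b
          n , eq    = unpair-surjective (i , j)
      in  n , cong₂ _,_ (trans (cong (e ∘ proj₁) eq) ei≡a) (trans (cong (e′ ∘ proj₂) eq) e′j≡b)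

  enumerate-Vec : ∀ {A : Set} → Enumeration A → ∀ d → Enumeration (Vec A d)
  enumerate-Vec e zero    = (λ _ → []) , λ { [] → 0 , refl }
  enumerate-Vec e (suc d) =
    enumerate-map (uncurry _∷_) (λ { (x ∷ xs) → (x , xs) , refl }) (enumerate-× e (enumerate-Vec e d))

  enumerate-Σ-Vec : ∀ {A : Set} → Enumeration A → Enumeration (Σ ℕ (Vec A))
  enumerate-Σ-Vec {A} e = enumerate ∘ unpair , surjective
    where
    enumerate : ℕ × ℕ → Σ ℕ (Vec A)
    enumerate (d , k) = d , proj₁ (enumerate-Vec e d) k
    surjective : StrictlySurjective _≡_ (enumerate ∘ unpair)
    surjective (d , xs) =
      let k , eq = proj₂ (enumerate-Vec e d) xs
          n , unpair[n]≡ = unpair-surjective (d , k)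
      in  n , trans (cong enumerate unpair[n]≡) (cong (d ,_) eq)

  enumerate-List : ∀ {A : Set} → Enumeration A → Enumeration (List A)
  enumerate-List e = enumerate-map (toList ∘ proj₂) (λ xs → (length xs , fromList xs) , toList∘fromList xs)
                                   (enumerate-Σ-Vec e)

  enumerate-ℤ : Enumeration ℤ
  enumerate-ℤ = enumerate-map (λ (m , n) → + m ℤ.- + n) surjective (unpair , unpair-surjective)
    where
    surjective : StrictlySurjective _≡_ (λ (m , n) → + m ℤ.- + n)
    surjective (+ m)    = (m , 0) , ℤ.+-identityʳ (+ m)
    surjective -[1+ n ] = (0 , suc n) , ℤ.+-identityˡ -[1+ n ]

module CoordinateChoice where

  open import Data.Nat as ℕ using (ℕ; zero; suc; _+_; _<_; _≤_; _<?_; _∸_)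
  import Data.Nat.Properties as ℕ
  open import Data.Nat.Primality using (Prime; prime?)
  open import Data.Nat.ListAction using (sum)
  open import Data.Integer using (ℤ; +_; _^_)
  open import Data.List using (List; length; map; applyDownFrom)
  open import Data.List.Membership.Propositional.Properties using (∈-applyDownFrom⁺)
  import Data.List.Relation.Unary.All as All
  open import Data.Vec as Vec using (Vec; []; _∷_; toList)
  open import Data.Product using (Σ; _×_; _,_; proj₁; proj₂)
  open import Data.Sum using (inj₁; inj₂)
  open import Data.Empty using (⊥-elim)
  open import Relation.Nullary using (yes; no)
  open import Relation.Nullary.Decidable using (_×-dec_)
  open import Relation.Binary.PropositionalEquality
  open IntegerPolynomial using (eval)
  open NatArithmetic using (prime⇒∸1≢0)
  open Enumeration

  -- (d , hs) stands for the polynomial Σ_{k < d} hs[k](i) Y^k, as in AlgOver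
  Poly : Set
  Poly = Σ ℕ (Vec (List ℤ))

  polys : Enumeration Poly
  polys = enumerate-Σ-Vec (enumerate-List enumerate-ℤ)

  specialise : ℤ → Poly → List ℤ
  specialise I (d , hs) = toList (Vec.map (λ h → eval h I) hs)

  length-specialise : ∀ I p → length (specialise I p) ≡ proj₁ p
  length-specialise I (zero  , [])     = refl
  length-specialise I (suc d , h ∷ hs) = cong suc (length-specialise I (d , hs))

  candidate : ℤ → ℕ → List ℤ
  candidate I n = specialise I (proj₁ polys n)

  cost : ℕ → ℕ
  cost zero    = 0
  cost (suc n) = proj₁ (proj₁ polys n) + cost n

  sum-length-candidates : ∀ I N → sum (map length (applyDownFrom (candidate I) N)) ≡ cost N
  sum-length-candidates I zero    = refl
  sum-length-candidates I (suc N) =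
    cong₂ _+_ (length-specialise I (proj₁ polys N)) (sum-length-candidates I N)

  affordable : ℕ → ℕ → ℕ
  affordable J zero    = 0
  affordable J (suc k) with cost (suc k) <? J
  ... | yes _ = suc k
  ... | no  _ = affordable J k

  cost-affordable : ∀ {J} k → 0 < J → cost (affordable J k) < J
  cost-affordable {J} zero    0<J = 0<J
  cost-affordable {J} (suc k) 0<J with cost (suc k) <? J
  ... | yes cost<J = cost<J
  ... | no  _      = cost-affordable k 0<J

  ≤-affordable : ∀ {J n} k → n ≤ k → cost n < J → n ≤ affordable J k
  ≤-affordable {J} {n} zero    ℕ.z≤n _      = ℕ.z≤n
  ≤-affordable {J} {n} (suc k) n≤1+k cost<J with cost (suc k) <? J
  ... | yes _ = n≤1+k
  ... | no  cost≮J with ℕ.m≤n⇒m<n∨m≡n n≤1+k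
  ...   | inj₁ n<1+k = ≤-affordable k (ℕ.s≤s⁻¹ n<1+k) cost<J
  ...   | inj₂ refl  = ⊥-elim (cost≮J cost<J)

  record AvoidingPrimitiveRoot (P C J : ℕ) (I ε : ℤ) : Set where
    field
      isPrimitive : MultiplicativeOrder.HasOrder P ε (P ∸ 1)
      avoids      : ∀ {n} → n < affordable J J → Congruence.Avoids P (ε ^ C) (candidate I n)

  ∃-avoidingPrimitiveRoot : ∀ {P C J} → Prime P → C ℕ.* (J ℕ.* J) ≡ P ∸ 1 →
                            ∀ I → Σ ℤ (AvoidingPrimitiveRoot P C J I)
  ∃-avoidingPrimitiveRoot {P} {C} {J} P-prime CJ²≡P∸1 I =
    let ε , ε-primitive , ε^C-avoids =
          MultiplicativeOrder.∃-primitiveRoot-avoiding P P-prime {C} {J} CJ²≡P∸1 candidates budget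
    in  ε , record { isPrimitive = ε-primitive
                   ; avoids      = λ n<N → All.lookup ε^C-avoids (∈-applyDownFrom⁺ (candidate I) n<N) }
    where
    candidates = applyDownFrom (candidate I) (affordable J J)
    instance _ = subst ℕ.NonZero (sym CJ²≡P∸1) (prime⇒∸1≢0 P-prime)
    0<J : 0 < J
    0<J = ℕ.>-nonZero⁻¹ J {{ℕ.m*n≢0⇒m≢0 J {{ℕ.m*n≢0⇒n≢0 C}}}}
    budget : sum (map length candidates) < J
    budget = subst (_< J) (sym (sum-length-candidates I (affordable J J))) (cost-affordable J 0<J)

  -- The hypotheses are decidable, so a root can be chosen at every coordinate (0 where they fail).
  coordinateRoot : (P C J : ℕ) → ℤ → ℤ
  coordinateRoot P C J I with prime? P ×-dec (C ℕ.* (J ℕ.* J) ℕ.≟ P ∸ 1)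
  ... | yes (P-prime , CJ²≡P∸1) = proj₁ (∃-avoidingPrimitiveRoot {P} {C} {J} P-prime CJ²≡P∸1 I)
  ... | no  _                   = + 0

  coordinateRoot-avoiding : ∀ {P C J} → Prime P → C ℕ.* (J ℕ.* J) ≡ P ∸ 1 →
                            ∀ I → AvoidingPrimitiveRoot P C J I (coordinateRoot P C J I)
  coordinateRoot-avoiding {P} {C} {J} P-prime CJ²≡P∸1 I with prime? P ×-dec (C ℕ.* (J ℕ.* J) ℕ.≟ P ∸ 1)
  ... | yes (P-prime′ , CJ²≡P∸1′) = proj₂ (∃-avoidingPrimitiveRoot {P} {C} {J} P-prime′ CJ²≡P∸1′ I)
  ... | no  ¬hypotheses           = ⊥-elim (¬hypotheses (P-prime , CJ²≡P∸1))

module AtCoordinate where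

  open import Data.Nat as ℕ using (ℕ; suc; _+_; _<_; _≤_; _∸_)
  import Data.Nat.Properties as ℕ
  import Data.Nat.Divisibility as ℕ
  open import Data.Nat.Primality using (Prime; prime⇒nonZero)
  open import Data.Integer as ℤ using (ℤ; +_; ∣_∣; _-_; _*_; _^_)
  import Data.Integer.Properties as ℤ
  open import Data.Integer.Divisibility.Signed using (∣ᵤ⇒∣; ∣⇒∣ᵤ) renaming (_∣_ to _∣ℤ_)
  open import Data.Fin using (zero; suc)
  open import Data.Vec using (Vec; _∷_; lookup)
  open import Data.List.Relation.Unary.All using (_∷_)
  open import Data.Product using (∃; _,_; proj₁)
  open import Function.Bundles using (_⇔_; mk⇔)
  open import Relation.Nullary using (¬_)
  open import Relation.Binary.PropositionalEquality
  open IntegerPolynomial using (eval)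
  open NatArithmetic using (prime⇒∸1≢0)
  open CoordinateChoice

  record Hypotheses (p i c j : ℤ) : Set where
    field
      1<p     : + 1 ℤ.< p
      p-prime : Prime ∣ p ∣
      j*j≡i   : j * j ≡ i
      p-1≡c*i : p - + 1 ≡ c * i

  ε-at : ℤ → ℤ → ℤ → ℤ → ℤ
  ε-at p i c j = coordinateRoot (∣ p ∣) (∣ c ∣) (∣ j ∣) i

  IsZero-specialise : ∀ {P I d} (hs : Vec _ d) → Congruence.IsZero P (specialise I (d , hs)) →
                      ∀ k → Congruence._≈_ P (eval (lookup hs k) I) (+ 0)
  IsZero-specialise (h ∷ hs) (h[I]≈0 ∷ _)   zero    = h[I]≈0
  IsZero-specialise (h ∷ hs) (_ ∷ hs[I]≈0) (suc k) = IsZero-specialise hs hs[I]≈0 k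

  module _ {p i c j} (hyp : Hypotheses p i c j) where

    open Hypotheses hyp
    open Congruence ∣ p ∣ using (mk≈; P∣a-b)
    open MultiplicativeOrder ∣ p ∣ using (^≈1⇒∣; ∣⇒^≈1)

    p≡+∣p∣ : p ≡ + ∣ p ∣
    p≡+∣p∣ = sym (ℤ.0≤i⇒+∣i∣≡i (ℤ.<⇒≤ (ℤ.<-trans (ℤ.+<+ ℕ.z<s) 1<p)))

    ∣p-1∣≡∣p∣∸1 : ∣ p - + 1 ∣ ≡ ∣ p ∣ ∸ 1
    ∣p-1∣≡∣p∣∸1 = cong ∣_∣ (trans (cong (_- + 1) p≡+∣p∣)
      (trans (ℤ.[+m]-[+n]≡m⊖n ∣ p ∣ 1) (ℤ.⊖-≥ (ℕ.>-nonZero⁻¹ ∣ p ∣ {{prime⇒nonZero p-prime}}))))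

    CJ²≡P∸1 : ∣ c ∣ ℕ.* (∣ j ∣ ℕ.* ∣ j ∣) ≡ ∣ p ∣ ∸ 1
    CJ²≡P∸1 = begin
      ∣ c ∣ ℕ.* (∣ j ∣ ℕ.* ∣ j ∣)  ≡⟨ cong (∣ c ∣ ℕ.*_) (ℤ.abs-* j j) ⟨
      ∣ c ∣ ℕ.* ∣ j * j ∣          ≡⟨ ℤ.abs-* c (j * j) ⟨
      ∣ c * (j * j) ∣              ≡⟨ cong (λ t → ∣ c * t ∣) j*j≡i ⟩
      ∣ c * i ∣                    ≡⟨ cong ∣_∣ p-1≡c*i ⟨
      ∣ p - + 1 ∣                  ≡⟨ ∣p-1∣≡∣p∣∸1 ⟩
      ∣ p ∣ ∸ 1                    ∎
      where open ≡-Reasoning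

    ε-avoiding : AvoidingPrimitiveRoot (∣ p ∣) (∣ c ∣) (∣ j ∣) i (ε-at p i c j)
    ε-avoiding = coordinateRoot-avoiding p-prime CJ²≡P∸1 i

    open AvoidingPrimitiveRoot ε-avoiding

    ε-order : ∀ η → (p ∣ℤ ε-at p i c j ^ ∣ η ∣ - + 1) ⇔ (p - + 1 ∣ℤ η)
    ε-order η = mk⇔
      (λ p∣ε^η-1 → ∣ᵤ⇒∣ (subst (ℕ._∣ ∣ η ∣) (sym ∣p-1∣≡∣p∣∸1)
         (^≈1⇒∣ isPrimitive {∣ η ∣} (mk≈ (subst (_∣ℤ ε^η-1) p≡+∣p∣ p∣ε^η-1)))))
      (λ p-1∣η → subst (_∣ℤ ε^η-1) (sym p≡+∣p∣)
         (P∣a-b (∣⇒^≈1 isPrimitive {∣ η ∣} (subst (ℕ._∣ ∣ η ∣) ∣p-1∣≡∣p∣∸1 (∣⇒∣ᵤ p-1∣η)))))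
      where
      ε^η-1 = ε-at p i c j ^ ∣ η ∣ - + 1

    private instance
      CJ²-nonZero : ℕ.NonZero (∣ c ∣ ℕ.* (∣ j ∣ ℕ.* ∣ j ∣))
      CJ²-nonZero = subst ℕ.NonZero (sym CJ²≡P∸1) (prime⇒∸1≢0 p-prime)

    c-unique : ∀ {c′} → p - + 1 ≡ c′ * i → c′ ≡ c
    c-unique {c′} p-1≡c′*i = ℤ.*-cancelʳ-≡ c′ c i {{i-nonZero}} (trans (sym p-1≡c′*i) p-1≡c*i)
      where
      i-nonZero : ℤ.NonZero i
      i-nonZero = subst (λ t → ℕ.NonZero ∣ t ∣) j*j≡i
        (subst ℕ.NonZero (sym (ℤ.abs-* j j)) (ℕ.m*n≢0⇒n≢0 (∣ c ∣)))

    ∣j⇒≤∣j∣ : ∀ {n} → + n ∣ℤ j → n ≤ ∣ j ∣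
    ∣j⇒≤∣j∣ n∣j = ℕ.∣⇒≤ {{ℕ.m*n≢0⇒m≢0 (∣ j ∣) {{ℕ.m*n≢0⇒n≢0 (∣ c ∣)}}}} (∣⇒∣ᵤ n∣j)

    ε-avoids : ∀ {d hs} n → proj₁ polys n ≡ (d , hs) → + suc (n + cost (suc n)) ∣ℤ j →
               (∃ λ k → ¬ p ∣ℤ eval (lookup hs k) i - + 0) →
               ¬ p ∣ℤ eval (specialise i (d , hs)) (ε-at p i c j ^ ∣ c ∣) - + 0
    ε-avoids {d} {hs} n refl T∣j (k , p∤h[i]) p∣f[α] =
      avoids n<N (λ f≈0 → p∤h[i] (subst (_∣ℤ _) (sym p≡+∣p∣) (P∣a-b (IsZero-specialise hs f≈0 k))))
                 (mk≈ (subst (_∣ℤ eval (candidate i n) (ε-at p i c j ^ ∣ c ∣) - + 0) p≡+∣p∣ p∣f[α]))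
      where
      n<N : n < affordable (∣ j ∣) (∣ j ∣)
      n<N = ≤-affordable (∣ j ∣) (ℕ.≤-trans (ℕ.s≤s (ℕ.m≤m+n n _)) (∣j⇒≤∣j∣ T∣j))
                                 (ℕ.≤-trans (ℕ.s≤s (ℕ.m≤n+m _ n)) (∣j⇒≤∣j∣ T∣j))

module Ultrapower (D : Ultrafilter) where

  open import Data.Nat as ℕ using (ℕ; suc)
  import Data.Nat.Properties as ℕ
  import Data.Nat.Divisibility as ℕ
  open import Data.Nat.Primality using (Prime)
  open import Data.Integer as ℤ using (ℤ; +_; -[1+_]; ∣_∣)
  import Data.Integer.Properties as ℤ
  open import Data.Integer.Divisibility.Signed as ℤ∣ using (divides; _∣?_; ∣ᵤ⇒∣; ∣⇒∣ᵤ) renaming (_∣_ to _∣ℤ_)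
  open import Data.List using (List; []; _∷_)
  open import Data.Vec as Vec using (Vec; []; _∷_)
  open import Data.Product using (_,_; _×_; proj₁; proj₂)
  open import Data.Sum using (inj₁; inj₂; [_,_]′)
  open import Data.Empty using (⊥; ⊥-elim)
  open import Function using (_$_)
  open import Function.Bundles using (_⇔_; mk⇔; Equivalence)
  open import Relation.Nullary using (¬_; yes; no)
  open import Relation.Binary.PropositionalEquality
  open Ultrafilter D
  open UP D
  open IntegerPolynomial using (eval)
  open CoordinateChoice using (polys; cost; specialise)
  open AtCoordinate

  almost-∅ : ∀ {A : PrimeIdx → Set} → member A → (∀ {q} → ¬ A q) → ⊥
  almost-∅ A-large ¬A = proper (upward ¬A A-large)

  ∣⇒almost-∣ : ∀ {a b} → a ∣ b → member (λ q → a q ∣ℤ b q)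
  ∣⇒almost-∣ (c , b≈c*a) = upward (divides (c _)) b≈c*a

  almost-∣⇒∣ : ∀ {a b} → member (λ q → a q ∣ℤ b q) → a ∣ b
  almost-∣⇒∣ {a} {b} a∣b-large = (λ q → quotient (a q) (b q)) , upward quotient-spec a∣b-large
    where
    -- junk value 0 where a does not divide b
    quotient : ℤ → ℤ → ℤ
    quotient a b with a ∣? b
    ... | yes a∣b = ℤ∣.quotient a∣b
    ... | no  _   = + 0
    quotient-spec : ∀ {a b} → a ∣ℤ b → b ≡ quotient a b ℤ.* a
    quotient-spec {a} {b} a∣b with a ∣? b
    ... | yes a∣b′ = ℤ∣._∣_.equality a∣b′
    ... | no  a∤b  = ⊥-elim (a∤b a∣b)

  ∤⇒almost-∤ : ∀ {a b} → ¬ a ∣ b → member (λ q → ¬ a q ∣ℤ b q)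
  ∤⇒almost-∤ {a} {b} a∤b with ultra (λ q → a q ∣ℤ b q)
  ... | inj₁ a∣b-large = ⊥-elim (a∤b (almost-∣⇒∣ a∣b-large))
  ... | inj₂ a∤b-large = a∤b-large

  IsPrime⇒almost-prime : ∀ {p} → IsPrime p → member (λ q → Prime ∣ p q ∣)
  IsPrime⇒almost-prime {p} (1<p , p-prime) with ultra (λ q → Prime ∣ p q ∣)
  ... | inj₁ prime-large     = prime-large
  ... | inj₂ not-prime-large = ⊥-elim $
    [ p∤ proj₁ (λ h → ProperFactors.0<a (factors-proper h) , ProperFactors.a<n (factors-proper h))
    , p∤ proj₂ (λ h → ProperFactors.0<b (factors-proper h) , ProperFactors.b<n (factors-proper h)) ]′
    (p-prime (λ q → + proj₁ (factors q)) (λ q → + proj₂ (factors q)) (almost-∣⇒∣ (upward p∣ab not-prime∧1<p)))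
    where
    open NatArithmetic using (splitComposite; splitComposite-proper; ProperFactors)
    not-prime∧1<p = meet not-prime-large 1<p
    factors = λ q → splitComposite ∣ p q ∣
    1<∣z∣ : ∀ {z} → + 1 ℤ.< z → 1 ℕ.< ∣ z ∣
    1<∣z∣ {+ _}      (ℤ.+<+ 1<n) = 1<n
    1<∣z∣ { -[1+ _ ]} ()
    factors-proper : ∀ {q} → ¬ Prime ∣ p q ∣ × + 1 ℤ.< p q →
                     ProperFactors ∣ p q ∣ (proj₁ (factors q)) (proj₂ (factors q))
    factors-proper (¬prime , 1<p[q]) = splitComposite-proper (1<∣z∣ 1<p[q]) ¬prime
    p∣ab : ∀ {q} → ¬ Prime ∣ p q ∣ × + 1 ℤ.< p q → p q ∣ℤ + proj₁ (factors q) ℤ.* + proj₂ (factors q)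
    p∣ab {q} h@(_ , 1<p[q]) = divides (+ 1) (begin
      + proj₁ (factors q) ℤ.* + proj₂ (factors q) ≡⟨ ℤ.pos-* (proj₁ (factors q)) (proj₂ (factors q)) ⟨
      + (proj₁ (factors q) ℕ.* proj₂ (factors q)) ≡⟨ cong +_ (ProperFactors.a*b≡n (factors-proper h)) ⟩
      + ∣ p q ∣                                   ≡⟨ ℤ.0≤i⇒+∣i∣≡i (ℤ.<⇒≤ (ℤ.<-trans (ℤ.+<+ ℕ.z<s) 1<p[q])) ⟩
      p q                                         ≡⟨ ℤ.*-identityˡ (p q) ⟨
      + 1 ℤ.* p q                                 ∎)
      where open ≡-Reasoning
    p∤ : ∀ (factor : ℕ × ℕ → ℕ) → (∀ {q} → ¬ Prime ∣ p q ∣ × + 1 ℤ.< p q →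
           0 ℕ.< factor (factors q) × factor (factors q) ℕ.< ∣ p q ∣) → ¬ p ∣ (λ q → + factor (factors q))
    p∤ factor bounds p∣factor = almost-∅ (meet not-prime∧1<p (∣⇒almost-∣ p∣factor)) λ (h , p[q]∣) →
      let 0<f , f<p = bounds h in ℕ.<⇒≱ f<p (ℕ.∣⇒≤ {{ℕ.>-nonZero 0<f}} (∣⇒∣ᵤ p[q]∣))

  polyEval-at : ∀ h x q → polyEval h x q ≡ eval h (x q)
  polyEval-at []       x q = refl
  polyEval-at (c ∷ cs) x q = cong (λ t → c ℤ.+ x q ℤ.* t) (polyEval-at cs x q)

  sumPow-at : ∀ {d} (hs : Vec (List ℤ) d) x y q →
              sumPow (Vec.map (λ h → polyEval h x) hs) y q ≡ eval (specialise (x q) (d , hs)) (y q)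
  sumPow-at []       x y q = refl
  sumPow-at (h ∷ hs) x y q = cong₂ (λ a b → a ℤ.+ y q ℤ.* b) (polyEval-at h x q) (sumPow-at hs x y q)

  chosenRoot : (p i c j : *ℤ) → *ℤ
  chosenRoot p i c j q = ε-at (p q) (i q) (c q) (j q)

  module _ {p i c j : *ℤ} (hypotheses : member (λ q → Hypotheses (p q) (i q) (c q) (j q))) where

    chosenRoot-order : ∀ η → (pow (chosenRoot p i c j) η ≡ κ (+ 1) [mod p ]) ⇔ (p - κ (+ 1) ∣ η)
    chosenRoot-order η = mk⇔
      (λ ε^η≡1 → almost-∣⇒∣ (upward (λ (H , p∣) → Equivalence.to (ε-order H (η _)) p∣)
                                    (meet hypotheses (∣⇒almost-∣ ε^η≡1))))
      (λ p-1∣η → almost-∣⇒∣ (upward (λ (H , p-1∣) → Equivalence.from (ε-order H (η _)) p-1∣)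
                                    (meet hypotheses (∣⇒almost-∣ p-1∣η))))

    chosenRoot-transcendental : (∀ T → member (λ q → + suc T ∣ℤ j q)) →
                                ∀ c′ → p - κ (+ 1) ≈ c′ * i → ¬ AlgOver p i (pow (chosenRoot p i c j) c′)
    chosenRoot-transcendental j-large c′ p-1≈c′*i (d , hs , (k , p∤h[i]) , p∣f[α]) =
      let n , polys[n]≡ = proj₂ polys (d , hs)
      in  almost-∅ (meet (meet hypotheses p-1≈c′*i)
                         (meet (j-large (n ℕ.+ cost (suc n))) (meet (∤⇒almost-∤ p∤h[i]) (∣⇒almost-∣ p∣f[α]))))
            λ {q} ((H , p-1≡c′*i) , T∣j , p∤ , p∣) →
              ε-avoids H n polys[n]≡ T∣j
                (k , subst (λ t → ¬ p q ∣ℤ t ℤ.- + 0) (polyEval-at (Vec.lookup hs k) i q) p∤)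
                (subst (λ c″ → p q ∣ℤ eval (specialise (i q) (d , hs)) (chosenRoot p i c j q ℤ.^ ∣ c″ ∣) ℤ.- + 0)
                       (c-unique H {c′ q} p-1≡c′*i)
                       (subst (λ t → p q ∣ℤ t ℤ.- + 0) (sumPow-at hs i (pow (chosenRoot p i c j) c′) q) p∣))

lemma3p3 : (D : Ultrafilter) → NonPrincipal D →
    let open UP D in
    (p i : *ℤ) → IsPrime p →
    (Σ *ℤ λ l → Σ *ℤ λ m → Σ *ℤ λ j →
       (∀ (n : ℕ) → κ (+ suc n) ∣ m) × (m * m ≈ l) × (m ∣ j)
       × (j * j ≈ i) × (i ∣ p - κ (+ 1))) →
    (¬ (i * i ≈ p - κ (+ 1)) →
       ∀ (k : ℕ) (a : Vec ℤ k) → ¬ (monicEval i a ≡ κ (+ 0) [mod p ])) →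
    Σ *ℤ λ ε →
      (∀ (η : *ℤ) → (pow ε η ≡ κ (+ 1) [mod p ]) ⇔ (p - κ (+ 1) ∣ η))
      × (∀ (c : *ℤ) → p - κ (+ 1) ≈ c * i → ¬ AlgOver p i (pow ε c))
lemma3p3 D _ p i p-prime (_ , m , j , n∣m , _ , m∣j , j*j≈i , c₀ , p-1≈c₀*i) _ =
  chosenRoot p i c₀ j , chosenRoot-order hypotheses , chosenRoot-transcendental hypotheses j-large
  where
  open Ultrafilter D
  open Ultrapower D
  hypotheses : member (λ q → AtCoordinate.Hypotheses (p q) (i q) (c₀ q) (j q))
  hypotheses = upward (λ (((p[q]-prime , 1<p[q]) , j*j≡i) , p-1≡c₀*i) → record
      { 1<p = 1<p[q] ; p-prime = p[q]-prime ; j*j≡i = j*j≡i ; p-1≡c*i = p-1≡c₀*i })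
    (meet (meet (meet (IsPrime⇒almost-prime p-prime) (proj₁ p-prime)) j*j≈i) p-1≈c₀*i)
  j-large : ∀ T → member (λ q → + suc T ∣ℤ j q)
  j-large T = upward (λ (T∣m , m∣j) → ∣ℤ-trans T∣m m∣j) (meet (∣⇒almost-∣ (n∣m T)) (∣⇒almost-∣ m∣j))
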